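{- Let $n\geq2$, let $1\leq h\leq(p^n-1)/(p-1)-1$ be primitive, let $\chi=\omega^s\mu_\lambda$ ($s\in\mathbf{Z}$, $\lambda\in E^\times$) and $W=\operatorname{ind}(\omega_n^h)\otimes\chi$. Then the $E[\![X]\!]$-module $\mathrm{D}^\sharp(W)=\bigoplus_{j=0}^{n-1}E[\![X]\!]f_j$ is stable under $\psi$, and $\psi:\mathrm{D}^\sharp(W)\to\mathrm{D}^\sharp(W)$ is surjective.
   Context: $p$ prime, $E$ a finite extension of $\mathbf{F}_p$, $\mathcal{G}_{\mathbf{Q}_p}=\operatorname{Gal}(\overline{\mathbf{Q}}_p/\mathbf{Q}_p)$, $\chi_{\mathrm{cycl}}$ the cyclotomic character, $\omega=\chi_{\mathrm{cycl}}\bmod p$, $\mathcal{H}=\ker\chi_{\mathrm{cycl}}$, $\Gamma=\mathcal{G}_{\mathbf{Q}_p}/\mathcal{H}$, $\mu_\lambda$ the unramified character sending arithmetic Frobenius to $\lambda^{ -1}$. $\omega_n:\mathcal{G}_{\mathbf{Q}_{p^n}}\to\mathbf{F}_{p^n}^\times$, $g\mapsto\overline{g(\pi_n)/\pi_n}$ with $\pi_n^{p^n-1}=-p$; $h$ primitive means no divisor $d<n$ of $n$ has $h$ a multiple of $(p^n-1)/(p^d-1)$; $\operatorname{ind}(\omega_n^h)$ is the $n$-dimensional representation (unique up to isomorphism) with determinant $\omega^h$ and restriction to inertia (over $\overline{\mathbf{F}}_p$) $\bigoplus_i\omega_n^{p^ih}$. $\mathrm{D}(W)=(\mathbf{F}_p(\!(X)\!)^{\mathrm{sep}}\otimes_{\mathbf{F}_p}W)^{\mathcal{H}}$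 is Fontaine's $(\varphi,\Gamma)$-module over $E(\!(X)\!)$ ($X=\varepsilon-1$ in Fontaine's field, $\gamma(X)=(1+X)^{\chi_{\mathrm{cycl}}(\gamma)}-1$, $\varphi$ = $p$-th power). $\psi$: every $y\in\mathrm{D}(W)$ is uniquely $y=\sum_{j=0}^{p-1}(1+X)^j\varphi(y_j)$ and $\psi(y)=y_0$. $\mathrm{D}(W)$ has a basis $e_0,\dots,e_{n-1}$ with $\gamma(e_j)=\omega^s(\gamma)f_\gamma(X)^{hp^j(p-1)/(p^n-1)}e_j$ ($f_\gamma(X)=\omega(\gamma)X/\gamma(X)$), $\varphi(e_j)=\lambda e_{j+1}$ for $j\le n-2$, $\varphi(e_{n-1})=(-1)^{n-1}\lambda X^{ -h(p-1)}e_0$. Writing $h(p-1)=\sum_{k=0}^{n-1}i_kp^k$ with $0\le i_k\le p-1$, set $h_j=i_{n-j}+pi_{n-j+1}+\cdots+p^{j-1}i_{n-1}$ ($h_0=0$) and $f_j=X^{h_j}e_j$. -}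

module Defs where

open import Level using (0ℓ)
open import Data.Nat as ℕ using (ℕ; zero; suc; _∸_; _^_)
open import Data.Nat.Properties using (m^n≢0)
open import Data.Nat.DivMod using (_/_; _%_)
open import Data.Nat.Divisibility using (_∣_)
open import Data.Nat.Combinatorics using (_C_)
open import Data.Integer as ℤ using (ℤ; +_)
open import Data.Integer.DivMod using (_/ℕ_; _%ℕ_)
import Data.Fin
open import Data.Fin using (Fin; zero; suc; fromℕ; inject₁)
open import Data.Product using (Σ; ∃; _×_)
open import Relation.Nullary using (¬_)
open import Algebra.Bundles using (CommutativeRing)

sumℕ : ℕ → (ℕ → ℕ) → ℕ
sumℕ zero    f = 0
sumℕ (suc j) f = sumℕ j f ℕ.+ f j

-- k-th base-p digit of m  (p = 0 never occurs: p is prime)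
digit : ℕ → ℕ → ℕ → ℕ
digit zero    m k = 0
digit (suc q) m k = (m / (suc q ^ k)) {{m^n≢0 (suc q) k}} % suc q

iDig : (p h k : ℕ) → ℕ
iDig p h k = digit p (h ℕ.* (p ∸ 1)) k

hIdx : (p n h j : ℕ) → ℕ
hIdx p n h j = sumℕ j (λ m → p ^ m ℕ.* iDig p h ((n ∸ j) ℕ.+ m))

-- h primitive: no divisor d < n of n such that h is a multiple of
-- (p^n - 1)/(p^d - 1)  (the quotient q with q (p^d - 1) = p^n - 1)
Primitive : (p n h : ℕ) → Set
Primitive p n h =
  ∀ d → d ∣ n → d ℕ.< n →
    ¬ (Σ ℕ λ q → (q ℕ.* (p ^ d ∸ 1) ≡ p ^ n ∸ 1) × q ∣ h)
  where open import Relation.Binary.PropositionalEquality using (_≡_)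

module _ (E : CommutativeRing 0ℓ 0ℓ) where
  open CommutativeRing E

  natE : ℕ → Carrier
  natE zero    = 0#
  natE (suc k) = 1# + natE k

  IsFiniteFieldOfChar : ℕ → Set
  IsFiniteFieldOfChar p =
    ¬ (1# ≈ 0#)
    × (∀ x → ¬ (x ≈ 0#) → Σ Carrier λ y → x * y ≈ 1#)
    × (Σ ℕ λ N → Σ (Fin N → Carrier) λ enum → ∀ x → Σ (Fin N) λ i → enum i ≈ x)
    × natE p ≈ 0#

  IsUnit : Carrier → Set
  IsUnit x = Σ Carrier λ y → x * y ≈ 1#

-- Formal Laurent series over E, as coefficient functions ℤ → E,
-- and the (φ,Γ)-module D(W) ≅ E((X))^n in the basis e_0..e_{n-1}.

module Model (E : CommutativeRing 0ℓ 0ℓ) (p n h : ℕ) (lam : CommutativeRing.Carrier E) where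
  open CommutativeRing E

  Series : Set
  Series = ℤ → Carrier

  IsLaurent : Series → Set
  IsLaurent a = Σ ℤ λ N → ∀ k → k ℤ.< N → a k ≈ 0#

  sumE : ℕ → (ℕ → Carrier) → Carrier
  sumE zero    f = 0#
  sumE (suc j) f = sumE j f + f j

  powE : Carrier → ℕ → Carrier
  powE x zero    = 1#
  powE x (suc k) = x * powE x k

  -- φ on E((X)):  a(X) ↦ a(X^p)  (coefficient k is a_{k/p} if p ∣ k, else 0)
  φS' : ℕ → Series → Series
  φS' zero    a k = 0#
  φS' (suc q) a k with k %ℕ suc q
  ... | zero  = a (k /ℕ suc q)
  ... | suc _ = 0#

  φS : Series → Series
  φS = φS' p

  -- multiplication by X^m  (m ∈ ℤ)
  shiftX : ℤ → Series → Series
  shiftX m a k = a (k ℤ.- m)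

  -- multiplication by (1+X)^j = sum_i (j choose i) X^i
  mul1X : ℕ → Series → Series
  mul1X j a k = sumE (suc j) (λ i → natE E (j C i) * a (k ℤ.- + i))

  scale : Carrier → Series → Series
  scale c a k = c * a k

  -- elements of D(W):  y = sum_j y_j e_j, recorded as (y_j)_j
  Vect : Set
  Vect = Fin n → Series

  InD : Vect → Set
  InD y = ∀ j → IsLaurent (y j)

  -- φ(e_j) = λ e_{j+1} (j ≤ n-2),  φ(e_{n-1}) = (-1)^{n-1} λ X^{-h(p-1)} e_0,
  -- φ semilinear over φ on E((X)) and E-linear.
  φD' : (m : ℕ) → (Fin m → Series) → Fin m → Series
  φD' (suc m) y zero    = scale (powE (- 1#) m * lam)
                            (shiftX (ℤ.- (+ (h ℕ.* (p ∸ 1)))) (φS (y (fromℕ m))))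
  φD' (suc m) y (suc j) = scale lam (φS (y (inject₁ j)))

  φD : Vect → Vect
  φD = φD' n

  -- D♯(W) = ⊕_j E[[X]] f_j with f_j = X^{h_j} e_j :
  -- the coefficient of e_j lies in X^{h_j} E[[X]]
  InDsharp : Vect → Set
  InDsharp y = ∀ j k → k ℤ.< + hIdx p n h (Data.Fin.toℕ j) → y j k ≈ 0#

  -- ψ(y) = z  iff  y = sum_{j=0}^{p-1} (1+X)^j φ(y_j) with y_j ∈ D(W) and y_0 = z
  -- (such a decomposition exists and is unique)
  IsPsi : Vect → Vect → Set
  IsPsi y z = Σ (ℕ → Vect) λ ys →
      (∀ j → j ℕ.< p → InD (ys j))
    × (∀ c k → ys 0 c k ≈ z c k)
    × (∀ c k → y c k ≈ sumE p (λ j → mul1X j (φD (ys j) c) k))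

{-# OPTIONS --safe #-}
module Submission where

-- Write y = Σ_{j<p} (1+X)^j φ(y_j).  For t < p the coefficient of X^(mp+t) in (1+X)^j φ(a) is
-- C(j,t) a_m, so the alternating sums Σ_t (-1)^t y_(mp+t) recover the coefficients of y_0 = ψ(y).
-- Since h_{j+1} = ⌊h(p-1)/p^(n-j-1)⌋ lies between p h_j and p h_j + p - 1, and h_n = h(p-1) absorbs
-- the factor X^(-h(p-1)) in φ(e_{n-1}), a coordinate of y vanishing below X^(h_{j+1}) forces the
-- matching coordinate of ψ(y) to vanish below X^(h_j).  For surjectivity take every y_j = z: in
-- characteristic p, Σ_{j<p} (1+X)^j = X^(p-1), so y = X^(p-1) φ(z), which lies in D♯.

open import Defs
open import Level using (0ℓ)
open import Data.Nat.Base using (ℕ; zero; suc)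
open import Data.Product using (Σ; _×_; _,_; proj₁; proj₂)
open import Algebra.Bundles using (CommutativeRing)

-- Throughout, p is written suc q: Defs' digit and φS compute only on a successor, and q = p - 1.
module _ (q : ℕ) where
  open import Data.Nat using (_+_; _*_; _^_; _∸_; _≤_; _<_; NonZero)
  open import Data.Nat.Properties
  open import Data.Nat.DivMod
  open import Data.Nat.Tactic.RingSolver using (solve-∀)
  open import Relation.Binary.PropositionalEquality
  open ≡-Reasoning

  private
    p = suc q

    _/p^_ : ℕ → ℕ → ℕ
    m /p^ k = (m / p ^ k) {{m^n≢0 p k}}

    /p^-suc : ∀ m k → m /p^ suc k ≡ m /p^ k / p
    /p^-suc m k = begin
      m /p^ suc k                 ≡⟨ /-congʳ {{m^n≢0 p (suc k)}} {{nz}} (*-comm p (p ^ k)) ⟩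
      (m / (p ^ k * p)) {{nz}}    ≡⟨ m/n/o≡m/[n*o] m (p ^ k) p {{m^n≢0 p k}} {{_}} {{nz}} ⟨
      m /p^ k / p                 ∎
      where
      nz : NonZero (p ^ k * p)
      nz = subst NonZero (*-comm p (p ^ k)) (m^n≢0 p (suc k))

    digits-expansion : ∀ m a j →
      sumℕ j (λ i → p ^ i * digit p m (a + i)) + p ^ j * m /p^ (a + j) ≡ m /p^ a
    digits-expansion m a zero = trans (+-identityʳ _) (cong (m /p^_) (+-identityʳ a))
    digits-expansion m a (suc j) = begin
      (s + p ^ j * (r % p)) + p * p ^ j * m /p^ (a + suc j)
        ≡⟨ cong (λ e → (s + p ^ j * (r % p)) + p * p ^ j * e)
             (trans (cong (m /p^_) (+-suc a j)) (/p^-suc m (a + j))) ⟩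
      (s + p ^ j * (r % p)) + p * p ^ j * (r / p)
        ≡⟨ regroup s (p ^ j) (r % p) (r / p) p ⟩
      s + p ^ j * (r % p + r / p * p)
        ≡⟨ cong (λ e → s + p ^ j * e) (m≡m%n+[m/n]*n r p) ⟨
      s + p ^ j * r
        ≡⟨ digits-expansion m a j ⟩
      m /p^ a ∎
      where
      s = sumℕ j (λ i → p ^ i * digit p m (a + i))
      r = m /p^ (a + j)
      regroup : ∀ s P r d p → (s + P * r) + p * P * d ≡ s + P * (r + d * p)
      regroup = solve-∀

    quotient-bounds : ∀ x → p * (x / p) ≤ x × x ≤ p * (x / p) + q
    quotient-bounds x =
      subst (_≤ x) (*-comm (x / p) p) (m/n*n≤m x p) ,
      subst₂ _≤_ (sym (m≡m%n+[m/n]*n x p))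
        (trans (+-comm q (x / p * p)) (cong (_+ q) (*-comm (x / p) p)))
        (+-monoˡ-≤ (x / p * p) (≤-pred (m%n<n x p)))

  module DigitIndices (n h : ℕ) (h[p-1]<pⁿ : h * q < p ^ n) where

    private
      hIdx≡quotient : ∀ {j} → j ≤ n → hIdx p n h j ≡ (h * q) /p^ (n ∸ j)
      hIdx≡quotient {j} j≤n = begin
        hIdx p n h j                                ≡⟨ +-identityʳ _ ⟨
        hIdx p n h j + 0                            ≡⟨ cong (hIdx p n h j +_) (*-zeroʳ (p ^ j)) ⟨
        hIdx p n h j + p ^ j * 0                    ≡⟨ cong (λ e → hIdx p n h j + p ^ j * e) quotient≡0 ⟨
        hIdx p n h j + p ^ j * H /p^ (n ∸ j + j)    ≡⟨ digits-expansion H (n ∸ j) j ⟩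
        H /p^ (n ∸ j)                               ∎
        where
        H = h * q
        quotient≡0 : H /p^ (n ∸ j + j) ≡ 0
        quotient≡0 = trans (cong (H /p^_) (m∸n+n≡m j≤n)) (m<n⇒m/n≡0 {{m^n≢0 p n}} h[p-1]<pⁿ)

      hIdx≡hIdx-suc/p : ∀ {j} → j < n → hIdx p n h j ≡ hIdx p n h (suc j) / p
      hIdx≡hIdx-suc/p {j} j<n = begin
        hIdx p n h j                  ≡⟨ hIdx≡quotient (<⇒≤ j<n) ⟩
        (h * q) /p^ (n ∸ j)           ≡⟨ cong ((h * q) /p^_) (+-∸-assoc 1 j<n) ⟩
        (h * q) /p^ suc (n ∸ suc j)   ≡⟨ /p^-suc (h * q) (n ∸ suc j) ⟩
        (h * q) /p^ (n ∸ suc j) / p   ≡⟨ cong (_/ p) (hIdx≡quotient j<n) ⟨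
        hIdx p n h (suc j) / p        ∎

    hIdx-n≡h[p-1] : hIdx p n h n ≡ h * q
    hIdx-n≡h[p-1] = trans (hIdx≡quotient ≤-refl) (trans (cong ((h * q) /p^_) (n∸n≡0 n)) (n/1≡n (h * q)))

    p*hIdx≤hIdx-suc : ∀ {j} → j < n → p * hIdx p n h j ≤ hIdx p n h (suc j)
    p*hIdx≤hIdx-suc {j} j<n =
      subst (λ e → p * e ≤ hIdx p n h (suc j)) (sym (hIdx≡hIdx-suc/p j<n))
        (proj₁ (quotient-bounds (hIdx p n h (suc j))))

    hIdx-suc≤p*hIdx+q : ∀ {j} → j < n → hIdx p n h (suc j) ≤ p * hIdx p n h j + q
    hIdx-suc≤p*hIdx+q {j} j<n =
      subst (λ e → hIdx p n h (suc j) ≤ p * e + q) (sym (hIdx≡hIdx-suc/p j<n))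
        (proj₂ (quotient-bounds (hIdx p n h (suc j))))

module _ where
  open import Data.Nat using (_+_; _*_; _<_; z≤n; s≤s; z<s)
  open import Data.Nat.Properties
  open import Data.Nat.Combinatorics
  open import Data.Nat.Divisibility using (_∣_; divides; ∣⇒≤)
  open import Data.Nat.Primality using (Prime; euclidsLemma)
  open import Data.Nat.Tactic.RingSolver using (solve-∀)
  open import Data.Sum using (inj₁; inj₂)
  open import Data.Empty using (⊥-elim)
  open import Relation.Binary.PropositionalEquality
  open ≡-Reasoning

  nC0≡1 : ∀ n → n C 0 ≡ 1
  nC0≡1 n = trans (nCk≡nC[n∸k] {n = n} z≤n) (nCn≡1 n)

  [1+k]*[1+n]C[1+k]≡[1+n]*nCk : ∀ n k → suc k * (suc n C suc k) ≡ suc n * (n C k)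
  [1+k]*[1+n]C[1+k]≡[1+n]*nCk n zero = begin
    1 * (suc n C 1)  ≡⟨ *-identityˡ _ ⟩
    suc n C 1        ≡⟨ nC1≡n (suc n) ⟩
    suc n            ≡⟨ *-identityʳ (suc n) ⟨
    suc n * 1        ≡⟨ cong (suc n *_) (nC0≡1 n) ⟨
    suc n * (n C 0)  ∎
  [1+k]*[1+n]C[1+k]≡[1+n]*nCk zero (suc k) = begin
    suc (suc k) * (1 C suc (suc k))  ≡⟨ cong (suc (suc k) *_) (k>n⇒nCk≡0 {1} {suc (suc k)} (s≤s z<s)) ⟩
    suc (suc k) * 0                  ≡⟨ *-zeroʳ (suc (suc k)) ⟩
    0                                ≡⟨ cong (1 *_) (k>n⇒nCk≡0 {0} {suc k} z<s) ⟨
    1 * (0 C suc k)                  ∎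
  [1+k]*[1+n]C[1+k]≡[1+n]*nCk (suc n) (suc k) = begin
    suc (suc k) * (suc (suc n) C suc (suc k))
      ≡⟨ cong (suc (suc k) *_) (nCk+nC[k+1]≡[n+1]C[k+1] (suc n) (suc k)) ⟨
    suc (suc k) * (a + b)
      ≡⟨ distribute a b k ⟩
    (suc k * a + a) + suc (suc k) * b
      ≡⟨ cong₂ (λ x y → (x + a) + y)
           ([1+k]*[1+n]C[1+k]≡[1+n]*nCk n k) ([1+k]*[1+n]C[1+k]≡[1+n]*nCk n (suc k)) ⟩
    (suc n * (n C k) + a) + suc n * (n C suc k)
      ≡⟨ collect (suc n) (n C k) (n C suc k) a ⟩
    suc n * (n C k + n C suc k) + a
      ≡⟨ cong (λ x → suc n * x + a) (nCk+nC[k+1]≡[n+1]C[k+1] n k) ⟩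
    suc n * a + a
      ≡⟨ +-comm (suc n * a) a ⟩
    suc (suc n) * a ∎
    where
    a = suc n C suc k
    b = suc n C suc (suc k)
    distribute : ∀ a b k → suc (suc k) * (a + b) ≡ (suc k * a + a) + suc (suc k) * b
    distribute = solve-∀
    collect : ∀ m x y z → (m * x + z) + m * y ≡ m * (x + y) + z
    collect = solve-∀

  prime∣pCk : ∀ {p k} → Prime p → 0 < k → k < p → p ∣ p C k
  prime∣pCk {suc n} {suc k} pr _ k<p
    with euclidsLemma (suc k) (suc n C suc k) pr
           (divides (n C k) (trans ([1+k]*[1+n]C[1+k]≡[1+n]*nCk n k) (*-comm (suc n) (n C k))))
  ... | inj₁ p∣k = ⊥-elim (<⇒≱ k<p (∣⇒≤ p∣k))
  ... | inj₂ p∣C = p∣C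

module _ {q : ℕ} where
  import Data.Nat as ℕ
  import Data.Nat.Properties as ℕ
  open import Data.Integer using (ℤ; +_; _+_; _-_; -_; _*_; _<_; _≤_; +<+; +≤+) renaming (suc to sucℤ)
  open import Data.Integer.Properties
  open import Data.Integer.DivMod using (_%ℕ_; _/ℕ_; n%ℕd<d; a≡a%ℕn+[a/ℕn]*n)
  open import Data.Integer.Tactic.RingSolver using (solve-∀)
  open import Data.Empty using (⊥-elim)
  open import Relation.Binary.PropositionalEquality
  open import Relation.Binary.Definitions using (tri<; tri≈; tri>)

  private
    p = suc q

    Q<Q′⇒euclid< : ∀ {r Q Q′} r′ → r ℕ.< p → Q < Q′ → + r + Q * + p < + r′ + Q′ * + p
    Q<Q′⇒euclid< {r} {Q} {Q′} r′ r<p Q<Q′ = begin-strict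
      + r + Q * + p    <⟨ +-monoˡ-< (Q * + p) (+<+ r<p) ⟩
      + p + Q * + p    ≡⟨ suc-* Q (+ p) ⟨
      sucℤ Q * + p     ≤⟨ *-monoʳ-≤-nonNeg (+ p) (i<j⇒suc[i]≤j Q<Q′) ⟩
      Q′ * + p         ≤⟨ i≤j+i (Q′ * + p) (+ r′) ⟩
      + r′ + Q′ * + p  ∎
      where open ≤-Reasoning

  euclid-unique : ∀ {r r′ Q Q′} → r ℕ.< p → r′ ℕ.< p →
    + r + Q * + p ≡ + r′ + Q′ * + p → r ≡ r′ × Q ≡ Q′
  euclid-unique {r} {r′} {Q} {Q′} r<p r′<p eq with <-cmp Q Q′
  ... | tri< Q<Q′ _ _ = ⊥-elim (<-irrefl eq (Q<Q′⇒euclid< r′ r<p Q<Q′))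
  ... | tri> _ _ Q>Q′ = ⊥-elim (<-irrefl (sym eq) (Q<Q′⇒euclid< r r′<p Q>Q′))
  ... | tri≈ _ refl _ = +-injective (∙-cancelʳ (Q * + p) (+ r) (+ r′) eq) , refl
    where
    open import Algebra.Properties.AbelianGroup +-0-abelianGroup using (∙-cancelʳ)

  euclid-%ℕ-/ℕ : ∀ {r} M → r ℕ.< p → (+ r + M * + p) %ℕ p ≡ r × (+ r + M * + p) /ℕ p ≡ M
  euclid-%ℕ-/ℕ {r} M r<p = euclid-unique (n%ℕd<d k p) r<p (sym (a≡a%ℕn+[a/ℕn]*n k p))
    where k = + r + M * + p

  index-on-multiple : ∀ t M → + t + M * + p - + t ≡ + 0 + M * + p
  index-on-multiple t M = identity (+ t) M (+ p)
    where
    identity : ∀ t M p → t + M * p - t ≡ + 0 + M * p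
    identity = solve-∀

  index-off-multiple : ∀ {t i} M → t ℕ.< p → i ℕ.< p → i ≢ t →
    Σ ℕ λ r → Σ ℤ λ M′ → 0 ℕ.< r × r ℕ.< p × + t + M * + p - + i ≡ + r + M′ * + p
  index-off-multiple {t} {i} M t<p i<p i≢t with ℕ.<-cmp i t
  ... | tri≈ _ i≡t _ = ⊥-elim (i≢t i≡t)
  ... | tri< i<t _ _ =
    t ℕ.∸ i , M , ℕ.m<n⇒0<n∸m i<t , ℕ.≤-<-trans (ℕ.m∸n≤m t i) t<p ,
    (begin
      + t + M * + p - + i                 ≡⟨ cong (λ e → e + M * + p - + i) t≡i+r ⟩
      + i + + (t ℕ.∸ i) + M * + p - + i   ≡⟨ identity (+ i) (+ (t ℕ.∸ i)) (M * + p) ⟩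
      + (t ℕ.∸ i) + M * + p               ∎)
    where
    open ≡-Reasoning
    t≡i+r : + t ≡ + i + + (t ℕ.∸ i)
    t≡i+r = trans (cong +_ (sym (ℕ.m+[n∸m]≡n (ℕ.<⇒≤ i<t)))) (pos-+ i (t ℕ.∸ i))
    identity : ∀ i r x → i + r + x - i ≡ r + x
    identity = solve-∀
  ... | tri> _ _ t<i =
    r , M - + 1 , ℕ.m<n⇒0<n∸m (ℕ.<-≤-trans i<p (ℕ.m≤m+n p t)) ,
    subst (r ℕ.<_) (ℕ.m+n∸n≡m p t) (ℕ.∸-monoʳ-< t<i (ℕ.≤-trans (ℕ.<⇒≤ i<p) (ℕ.m≤m+n p t))) ,
    (begin
      + t + M * + p - + i                 ≡⟨ borrow (+ t) M (+ p) (+ i) ⟩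
      + p + + t - + i + (M - + 1) * + p   ≡⟨ cong (λ e → e - + i + (M - + 1) * + p) p+t≡i+r ⟩
      + i + + r - + i + (M - + 1) * + p   ≡⟨ cancel (+ i) (+ r) ((M - + 1) * + p) ⟩
      + r + (M - + 1) * + p               ∎)
    where
    open ≡-Reasoning
    r = p ℕ.+ t ℕ.∸ i
    p+t≡i+r : + p + + t ≡ + i + + r
    p+t≡i+r = trans (sym (pos-+ p t))
      (trans (cong +_ (sym (ℕ.m+[n∸m]≡n (ℕ.≤-trans (ℕ.<⇒≤ i<p) (ℕ.m≤m+n p t))))) (pos-+ i r))
    borrow : ∀ t M p i → t + M * p - i ≡ p + t - i + (M - + 1) * p
    borrow = solve-∀
    cancel : ∀ i r x → i + r - i + x ≡ r + x
    cancel = solve-∀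

  M<c⇒euclid<p*c : ∀ {M c t} → M < + c → t ℕ.< p → + t + M * + p < + (p ℕ.* c)
  M<c⇒euclid<p*c {M} {c} {t} M<c t<p = begin-strict
    + t + M * + p     <⟨ +-monoˡ-< (M * + p) (+<+ t<p) ⟩
    + p + M * + p     ≡⟨ suc-* M (+ p) ⟨
    sucℤ M * + p      ≤⟨ *-monoʳ-≤-nonNeg (+ p) (i<j⇒suc[i]≤j M<c) ⟩
    + c * + p         ≡⟨ pos-* c p ⟨
    + (c ℕ.* p)       ≡⟨ cong +_ (ℕ.*-comm c p) ⟩
    + (p ℕ.* c)       ∎
    where open ≤-Reasoning

  %ℕ≡0⇒/ℕ< : ∀ {k c} → k %ℕ p ≡ 0 → k < + (p ℕ.* c) → k /ℕ p < + c
  %ℕ≡0⇒/ℕ< {k} {c} k%p≡0 k<pc = *-cancelʳ-<-nonNeg (+ p) (subst₂ _<_ k≡[k/p]p pc≡cp k<pc)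
    where
    k≡[k/p]p : k ≡ k /ℕ p * + p
    k≡[k/p]p = trans (a≡a%ℕn+[a/ℕn]*n k p) (trans (cong (λ r → + r + k /ℕ p * + p) k%p≡0) (+-identityˡ _))
    pc≡cp : + (p ℕ.* c) ≡ + c * + p
    pc≡cp = trans (cong +_ (ℕ.*-comm p c)) (pos-* c p)

  a≤b+q⇒a-q≤b : ∀ {a b} → a ℕ.≤ b ℕ.+ q → + a - + q ≤ + b
  a≤b+q⇒a-q≤b {a} {b} a≤b+q = begin
    + a - + q            ≤⟨ +-monoˡ-≤ (- + q) (+≤+ a≤b+q) ⟩
    + (b ℕ.+ q) - + q    ≡⟨ cong (_- + q) (pos-+ b q) ⟩
    + b + + q - + q      ≡⟨ cancel (+ b) (+ q) ⟩
    + b                  ∎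
    where
    open ≤-Reasoning
    cancel : ∀ b q → b + q - q ≡ b
    cancel = solve-∀

  c≤b+q⇒0-q≤b-c : ∀ {b c} → c ℕ.≤ b ℕ.+ q → + 0 - + q ≤ + b - + c
  c≤b+q⇒0-q≤b-c {b} {c} c≤b+q = begin
    + 0 - + q            ≡⟨ regroup (+ c) (+ q) ⟩
    + c - + q - + c      ≤⟨ +-monoˡ-≤ (- + c) (a≤b+q⇒a-q≤b c≤b+q) ⟩
    + b - + c            ∎
    where
    open ≤-Reasoning
    regroup : ∀ c q → + 0 - q ≡ c - q - c
    regroup = solve-∀

module Series (E : CommutativeRing 0ℓ 0ℓ) (q n h : ℕ) (lam : CommutativeRing.Carrier E) where
  open CommutativeRing E
  open Model E (suc q) n h lam
  import Data.Nat as ℕ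
  import Data.Nat.Properties as ℕ
  open import Data.Integer as ℤ using (ℤ; +_)
  import Data.Integer.Properties as ℤ
  open import Data.Integer.DivMod using (_%ℕ_; _/ℕ_)
  open import Data.Integer.Tactic.RingSolver using (solve-∀)
  open import Data.Nat.Combinatorics using (_C_; nCk+nC[k+1]≡[n+1]C[k+1]; k>n⇒nCk≡0; nCn≡1)
  open import Data.Nat.Divisibility using (divides)
  open import Data.Nat.Primality using (Prime)
  open import Data.Sum using (inj₁; inj₂)
  open import Data.Empty using (⊥-elim)
  open import Relation.Binary.PropositionalEquality as ≡ using (_≡_; _≢_)
  open import Relation.Binary.Reasoning.Setoid setoid
  open import Algebra.Properties.Ring ring using (-1*x≈-x; -‿distribˡ-*)
  open import Algebra.Properties.CommutativeSemigroup +-commutativeSemigroup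
    using () renaming (interchange to +-interchange)
  open import Algebra.Properties.CommutativeSemigroup *-commutativeSemigroup
    using (x∙yz≈y∙xz) renaming (interchange to *-interchange)

  private
    p = suc q

  *-≈0ʳ : ∀ {a b} → b ≈ 0# → a * b ≈ 0#
  *-≈0ʳ {a} b≈0 = trans (*-congˡ b≈0) (zeroʳ a)

  *-≈0ˡ : ∀ {a b} → a ≈ 0# → a * b ≈ 0#
  *-≈0ˡ {b = b} a≈0 = trans (*-congʳ a≈0) (zeroˡ b)

  sumE-cong : ∀ N {f g} → (∀ i → i ℕ.< N → f i ≈ g i) → sumE N f ≈ sumE N g
  sumE-cong zero    f≈g = refl
  sumE-cong (suc N) f≈g = +-cong (sumE-cong N (λ i i<N → f≈g i (ℕ.m<n⇒m<1+n i<N))) (f≈g N ℕ.≤-refl)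

  sumE-≈0 : ∀ N {f} → (∀ i → i ℕ.< N → f i ≈ 0#) → sumE N f ≈ 0#
  sumE-≈0 N f≈0 = trans (sumE-cong N f≈0) (zeros N)
    where
    zeros : ∀ N → sumE N (λ _ → 0#) ≈ 0#
    zeros zero    = refl
    zeros (suc N) = trans (+-identityʳ _) (zeros N)

  sumE-+ : ∀ N f g → sumE N (λ i → f i + g i) ≈ sumE N f + sumE N g
  sumE-+ zero    f g = sym (+-identityˡ 0#)
  sumE-+ (suc N) f g = trans (+-congʳ (sumE-+ N f g)) (+-interchange (sumE N f) (sumE N g) (f N) (g N))

  sumE-*ˡ : ∀ N c f → c * sumE N f ≈ sumE N (λ i → c * f i)
  sumE-*ˡ zero    c f = zeroʳ c
  sumE-*ˡ (suc N) c f = trans (distribˡ c (sumE N f) (f N)) (+-congʳ (sumE-*ˡ N c f))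

  sumE-*ʳ : ∀ N c f → sumE N f * c ≈ sumE N (λ i → f i * c)
  sumE-*ʳ N c f = trans (*-comm (sumE N f) c) (trans (sumE-*ˡ N c f) (sumE-cong N (λ i _ → *-comm c (f i))))

  sumE-swap : ∀ N M (f : ℕ → ℕ → Carrier) →
    sumE N (λ j → sumE M (f j)) ≈ sumE M (λ i → sumE N (λ j → f j i))
  sumE-swap zero    M f = sym (sumE-≈0 M (λ _ _ → refl))
  sumE-swap (suc N) M f = trans (+-congʳ (sumE-swap N M f)) (sym (sumE-+ M _ (f N)))

  sumE-single : ∀ N {f} t → t ℕ.< N → (∀ i → i ℕ.< N → i ≢ t → f i ≈ 0#) → sumE N f ≈ f t
  sumE-single (suc N) {f} t t<1+N others with ℕ.m≤n⇒m<n∨m≡n t<1+N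
  ... | inj₂ ≡.refl = begin
    sumE N f + f N  ≈⟨ +-congʳ (sumE-≈0 N (λ i i<N → others i (ℕ.m<n⇒m<1+n i<N) (ℕ.<⇒≢ i<N))) ⟩
    0# + f N        ≈⟨ +-identityˡ (f N) ⟩
    f N             ∎
  ... | inj₁ 1+t<1+N = begin
    sumE N f + f N  ≈⟨ +-cong (sumE-single N t (ℕ.≤-pred 1+t<1+N) (λ i i<N → others i (ℕ.m<n⇒m<1+n i<N)))
                              (others N ℕ.≤-refl (ℕ.>⇒≢ (ℕ.≤-pred 1+t<1+N))) ⟩
    f t + 0#        ≈⟨ +-identityʳ (f t) ⟩
    f t             ∎

  sumE-extend : ∀ {N M} f → N ℕ.≤ M → (∀ i → N ℕ.≤ i → i ℕ.< M → f i ≈ 0#) → sumE M f ≈ sumE N f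
  sumE-extend {M = zero}  f ℕ.z≤n _ = refl
  sumE-extend {N} {suc M} f N≤1+M beyond with ℕ.m≤n⇒m<n∨m≡n N≤1+M
  ... | inj₂ ≡.refl = refl
  ... | inj₁ N<1+M = begin
    sumE M f + f M  ≈⟨ +-cong (sumE-extend f N≤M (λ i N≤i i<M → beyond i N≤i (ℕ.m<n⇒m<1+n i<M)))
                              (beyond M N≤M ℕ.≤-refl) ⟩
    sumE N f + 0#   ≈⟨ +-identityʳ _ ⟩
    sumE N f        ∎
    where N≤M = ℕ.≤-pred N<1+M

  natE-+ : ∀ a b → natE E (a ℕ.+ b) ≈ natE E a + natE E b
  natE-+ zero    b = sym (+-identityˡ _)
  natE-+ (suc a) b = trans (+-congˡ (natE-+ a b)) (sym (+-assoc _ _ _))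

  natE-* : ∀ a b → natE E (a ℕ.* b) ≈ natE E a * natE E b
  natE-* zero    b = sym (zeroˡ _)
  natE-* (suc a) b = begin
    natE E (b ℕ.+ a ℕ.* b)             ≈⟨ natE-+ b (a ℕ.* b) ⟩
    natE E b + natE E (a ℕ.* b)        ≈⟨ +-cong (sym (*-identityˡ _)) (natE-* a b) ⟩
    1# * natE E b + natE E a * natE E b ≈⟨ distribʳ _ _ _ ⟨
    (1# + natE E a) * natE E b         ∎

  natE-jCi≈0 : ∀ {j i} → j ℕ.< i → natE E (j C i) ≈ 0#
  natE-jCi≈0 j<i = reflexive (≡.cong (natE E) (k>n⇒nCk≡0 j<i))

  natE-pascal : ∀ j i → natE E (j C i) + natE E (j C suc i) ≈ natE E (suc j C suc i)
  natE-pascal j i = trans (sym (natE-+ (j C i) (j C suc i))) (reflexive (≡.cong (natE E) (nCk+nC[k+1]≡[n+1]C[k+1] j i)))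

  hockey-stick : ∀ N i → sumE N (λ j → natE E (j C i)) ≈ natE E (N C suc i)
  hockey-stick zero    i = sym (natE-jCi≈0 {0} {suc i} ℕ.z<s)
  hockey-stick (suc N) i = trans (+-congʳ (hockey-stick N i)) (trans (+-comm _ _) (natE-pascal N i))

  sign : ℕ → Carrier
  sign = powE (- 1#)

  alternating-binomial-sum : ∀ j N → sumE (suc N) (λ t → sign t * natE E (suc j C t)) ≈ sign N * natE E (j C N)
  alternating-binomial-sum j zero = trans (+-identityˡ _)
    (*-congˡ (reflexive (≡.cong (natE E) (≡.trans (nC0≡1 (suc j)) (≡.sym (nC0≡1 j))))))
  alternating-binomial-sum j (suc N) = begin
    sumE (suc N) (λ t → sign t * natE E (suc j C t)) + sign (suc N) * natE E (suc j C suc N)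
      ≈⟨ +-cong (alternating-binomial-sum j N) (*-cong (-1*x≈-x s) (sym (natE-pascal j N))) ⟩
    s * a + - s * (a + b)
      ≈⟨ +-congˡ (distribˡ (- s) a b) ⟩
    s * a + (- s * a + - s * b)
      ≈⟨ +-assoc _ _ _ ⟨
    (s * a + - s * a) + - s * b
      ≈⟨ +-congʳ (trans (+-congˡ (sym (-‿distribˡ-* s a))) (-‿inverseʳ _)) ⟩
    0# + - s * b
      ≈⟨ +-identityˡ _ ⟩
    - s * b
      ≈⟨ *-congʳ (-1*x≈-x s) ⟨
    sign (suc N) * natE E (j C suc N) ∎
    where
    s = sign N
    a = natE E (j C N)
    b = natE E (j C suc N)

  VanishesBelow : ℤ → Series → Set
  VanishesBelow N a = ∀ k → k ℤ.< N → a k ≈ 0#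

  vanishesBelow-mono : ∀ {M N a} → M ℤ.≤ N → VanishesBelow N a → VanishesBelow M a
  vanishesBelow-mono M≤N a-van k k<M = a-van k (ℤ.<-≤-trans k<M M≤N)

  vanishesBelow-cong : ∀ {N a b} → (∀ k → a k ≈ b k) → VanishesBelow N a → VanishesBelow N b
  vanishesBelow-cong a≈b a-van k k<N = trans (sym (a≈b k)) (a-van k k<N)

  shiftX-vanishesBelow : ∀ {N a} d → VanishesBelow N a → VanishesBelow (N ℤ.+ d) (shiftX d a)
  shiftX-vanishesBelow {N} d a-van k k<N+d =
    a-van (k ℤ.- d) (≡.subst (k ℤ.- d ℤ.<_) (cancel N d) (ℤ.+-monoˡ-< (ℤ.- d) k<N+d))
    where
    cancel : ∀ N d → N ℤ.+ d ℤ.- d ≡ N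
    cancel = solve-∀

  vanishesBelow-unshift : ∀ {N a} d → VanishesBelow N (shiftX d a) → VanishesBelow (N ℤ.- d) a
  vanishesBelow-unshift {N} {a} d shifted-van k k<N-d = begin
    a k                    ≈⟨ reflexive (≡.cong a (cancel k d)) ⟨
    a (k ℤ.+ d ℤ.- d)      ≈⟨ shifted-van (k ℤ.+ d) k+d<N ⟩
    0#                     ∎
    where
    cancel : ∀ N d → N ℤ.+ d ℤ.- d ≡ N
    cancel = solve-∀
    uncancel : ∀ N d → N ℤ.- d ℤ.+ d ≡ N
    uncancel = solve-∀
    k+d<N : k ℤ.+ d ℤ.< N
    k+d<N = ≡.subst (k ℤ.+ d ℤ.<_) (uncancel N d) (ℤ.+-monoˡ-< d k<N-d)

  scale-vanishesBelow : ∀ {N a} c → VanishesBelow N a → VanishesBelow N (scale c a)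
  scale-vanishesBelow c a-van k k<N = *-≈0ʳ (a-van k k<N)

  vanishesBelow-unscale : ∀ {N a c} → IsUnit E c → VanishesBelow N (scale c a) → VanishesBelow N a
  vanishesBelow-unscale {a = a} {c} (c⁻¹ , cc⁻¹≈1) scaled-van k k<N = begin
    a k                ≈⟨ *-identityˡ (a k) ⟨
    1# * a k           ≈⟨ *-congʳ (trans (sym cc⁻¹≈1) (*-comm c c⁻¹)) ⟩
    (c⁻¹ * c) * a k    ≈⟨ *-assoc c⁻¹ c (a k) ⟩
    c⁻¹ * (c * a k)    ≈⟨ *-congˡ (scaled-van k k<N) ⟩
    c⁻¹ * 0#           ≈⟨ zeroʳ c⁻¹ ⟩
    0#                 ∎

  φS-at-multiple : ∀ a M → φS a (+ 0 ℤ.+ M ℤ.* + p) ≈ a M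
  φS-at-multiple a M with euclid-%ℕ-/ℕ M (ℕ.z<s {q})
  ... | rem≡0 , quot≡M rewrite rem≡0 = reflexive (≡.cong a quot≡M)

  φS-off-multiple : ∀ a {r} M → 0 ℕ.< r → r ℕ.< p → φS a (+ r ℤ.+ M ℤ.* + p) ≈ 0#
  φS-off-multiple a {suc r} M _ r<p with euclid-%ℕ-/ℕ M r<p
  ... | rem≡r , _ rewrite rem≡r = refl

  φS-vanishesBelow : ∀ {a c} → VanishesBelow (+ c) a → VanishesBelow (+ (p ℕ.* c)) (φS a)
  φS-vanishesBelow {a} a-van k k<pc with k %ℕ p in k%p≡r
  ... | zero  = a-van (k /ℕ p) (%ℕ≡0⇒/ℕ< k%p≡r k<pc)
  ... | suc _ = refl

  mul1X-scale : ∀ j c a k → mul1X j (scale c a) k ≈ c * mul1X j a k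
  mul1X-scale j c a k = sym (trans (sumE-*ˡ (suc j) c _) (sumE-cong (suc j) (λ i _ → x∙yz≈y∙xz c _ _)))

  mul1X-shiftX : ∀ j d a k → mul1X j (shiftX d a) k ≈ mul1X j a (k ℤ.- d)
  mul1X-shiftX j d a k = sumE-cong (suc j) (λ i _ → *-congˡ (reflexive (≡.cong a (swap k (+ i) d))))
    where
    swap : ∀ k i d → k ℤ.- i ℤ.- d ≡ k ℤ.- d ℤ.- i
    swap = solve-∀

  mul1X-φS : ∀ {j t} a M → j ℕ.< p → t ℕ.< p →
    mul1X j (φS a) (+ t ℤ.+ M ℤ.* + p) ≈ natE E (j C t) * a M
  mul1X-φS {j} {t} a M j<p t<p = begin
    sumE (suc j) f
      ≈⟨ sumE-extend f j<p (λ i j<i _ → *-≈0ˡ (natE-jCi≈0 j<i)) ⟨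
    sumE p f
      ≈⟨ sumE-single p t t<p off-t ⟩
    natE E (j C t) * φS a (k ℤ.- + t)
      ≈⟨ *-congˡ (trans (reflexive (≡.cong (φS a) (index-on-multiple t M))) (φS-at-multiple a M)) ⟩
    natE E (j C t) * a M ∎
    where
    k = + t ℤ.+ M ℤ.* + p
    f = λ i → natE E (j C i) * φS a (k ℤ.- + i)
    off-t : ∀ i → i ℕ.< p → i ≢ t → f i ≈ 0#
    off-t i i<p i≢t with index-off-multiple M t<p i<p i≢t
    ... | r , M′ , 0<r , r<p , k-i≡r+M′p =
      *-≈0ʳ (trans (reflexive (≡.cong (φS a) k-i≡r+M′p)) (φS-off-multiple a M′ 0<r r<p))

  recompose : (ℕ → Series) → Series
  recompose w k = sumE p (λ j → mul1X j (φS (w j)) k)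

  alternating-sum-recompose : ∀ w M → sumE p (λ t → sign t * recompose w (+ t ℤ.+ M ℤ.* + p)) ≈ w 0 M
  alternating-sum-recompose w M = begin
    sumE p (λ t → sign t * recompose w (+ t ℤ.+ M ℤ.* + p))
      ≈⟨ sumE-cong p (λ t t<p → *-congˡ (sumE-cong p (λ j j<p → mul1X-φS (w j) M j<p t<p))) ⟩
    sumE p (λ t → sign t * sumE p (λ j → natE E (j C t) * w j M))
      ≈⟨ sumE-cong p (λ t _ → sumE-*ˡ p (sign t) _) ⟩
    sumE p (λ t → sumE p (λ j → sign t * (natE E (j C t) * w j M)))
      ≈⟨ sumE-swap p p _ ⟩
    sumE p (λ j → sumE p (λ t → sign t * (natE E (j C t) * w j M)))
      ≈⟨ sumE-cong p (λ j _ → trans (sumE-cong p (λ t _ → sym (*-assoc _ _ _))) (sym (sumE-*ʳ p (w j M) _))) ⟩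
    sumE p (λ j → T j * w j M)
      ≈⟨ sumE-single p 0 ℕ.z<s (λ j j<p j≢0 → *-≈0ˡ (T-pos j<p j≢0)) ⟩
    T 0 * w 0 M
      ≈⟨ trans (*-congʳ T-zero) (*-identityˡ _) ⟩
    w 0 M ∎
    where
    T : ℕ → Carrier
    T j = sumE p (λ t → sign t * natE E (j C t))
    T-zero : T 0 ≈ 1#
    T-zero = trans (sumE-single p 0 ℕ.z<s (λ t _ t≢0 → *-≈0ʳ (natE-jCi≈0 (ℕ.n≢0⇒n>0 t≢0))))
                   (trans (*-identityˡ _) (+-identityʳ 1#))
    T-pos : ∀ {j} → j ℕ.< p → j ≢ 0 → T j ≈ 0#
    T-pos {zero}  _        0≢0 = ⊥-elim (0≢0 ≡.refl)
    T-pos {suc j} 1+j<1+q _   =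
      trans (alternating-binomial-sum j q) (*-≈0ʳ (natE-jCi≈0 (ℕ.≤-pred 1+j<1+q)))

  recompose-vanishesBelow : ∀ {c B} w → p ℕ.* c ℕ.≤ B →
    VanishesBelow (+ B) (recompose w) → VanishesBelow (+ c) (w 0)
  recompose-vanishesBelow w pc≤B recompose-van M M<c = begin
    w 0 M
      ≈⟨ alternating-sum-recompose w M ⟨
    sumE p (λ t → sign t * recompose w (+ t ℤ.+ M ℤ.* + p))
      ≈⟨ sumE-≈0 p (λ t t<p → *-≈0ʳ (recompose-van _ (ℤ.<-≤-trans (M<c⇒euclid<p*c M<c t<p) (ℤ.+≤+ pc≤B)))) ⟩
    0# ∎

  module _ (p-prime : Prime p) (char-p : natE E p ≈ 0#) where

    natE-pC[1+i]≈0 : ∀ {i} → i ℕ.< q → natE E (p C suc i) ≈ 0#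
    natE-pC[1+i]≈0 i<q with prime∣pCk p-prime ℕ.z<s (ℕ.s≤s i<q)
    ... | divides d pCk≡dp = trans (reflexive (≡.cong (natE E) pCk≡dp)) (trans (natE-* d p) (*-≈0ʳ char-p))

    geometric-sum-char-p : ∀ b k → sumE p (λ j → mul1X j b k) ≈ b (k ℤ.- + q)
    geometric-sum-char-p b k = begin
      sumE p (λ j → sumE (suc j) (f j))
        ≈⟨ sumE-cong p (λ j j<p → sumE-extend (f j) j<p (λ i j<i _ → *-≈0ˡ (natE-jCi≈0 j<i))) ⟨
      sumE p (λ j → sumE p (f j))
        ≈⟨ sumE-swap p p f ⟩
      sumE p (λ i → sumE p (λ j → f j i))
        ≈⟨ sumE-cong p (λ i _ → trans (sym (sumE-*ʳ p _ _)) (*-congʳ (hockey-stick p i))) ⟩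
      sumE p (λ i → natE E (p C suc i) * b (k ℤ.- + i))
        ≈⟨ sumE-single p q ℕ.≤-refl (λ i i<p i≢q → *-≈0ˡ (natE-pC[1+i]≈0 (ℕ.≤∧≢⇒< (ℕ.≤-pred i<p) i≢q))) ⟩
      natE E (p C p) * b (k ℤ.- + q)
        ≈⟨ *-congʳ (trans (reflexive (≡.cong (natE E) (nCn≡1 p))) (+-identityʳ 1#)) ⟩
      1# * b (k ℤ.- + q)
        ≈⟨ *-identityˡ _ ⟩
      b (k ℤ.- + q) ∎
      where
      f : ℕ → ℕ → Carrier
      f j i = natE E (j C i) * b (k ℤ.- + i)

  sign-unit : ∀ k → IsUnit E (sign k)
  sign-unit k = sign k , square≈1 k
    where
    open import Algebra.Properties.Ring ring using (-‿distribʳ-*; -‿involutive)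
    square≈1 : ∀ k → sign k * sign k ≈ 1#
    square≈1 zero    = *-identityˡ 1#
    square≈1 (suc k) = begin
      (- 1# * s) * (- 1# * s) ≈⟨ *-cong (-1*x≈-x s) (-1*x≈-x s) ⟩
      - s * - s               ≈⟨ -‿distribˡ-* s (- s) ⟨
      - (s * - s)             ≈⟨ -‿cong (-‿distribʳ-* s s) ⟨
      - - (s * s)             ≈⟨ -‿involutive (s * s) ⟩
      s * s                   ≈⟨ square≈1 k ⟩
      1#                      ∎
      where s = sign k

  unit-* : ∀ {a b} → IsUnit E a → IsUnit E b → IsUnit E (a * b)
  unit-* {a} {b} (a⁻¹ , aa⁻¹≈1) (b⁻¹ , bb⁻¹≈1) = a⁻¹ * b⁻¹ , (begin
    (a * b) * (a⁻¹ * b⁻¹)  ≈⟨ *-interchange a b a⁻¹ b⁻¹ ⟩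
    (a * a⁻¹) * (b * b⁻¹)  ≈⟨ *-cong aa⁻¹≈1 bb⁻¹≈1 ⟩
    1# * 1#                ≈⟨ *-identityˡ 1# ⟩
    1#                     ∎)

module _ (E : CommutativeRing 0ℓ 0ℓ) (q m h : ℕ) (lam : CommutativeRing.Carrier E) where
  open CommutativeRing E
  open Model E (suc q) (suc m) h lam
  open Series E q (suc m) h lam
  import Data.Nat as ℕ
  import Data.Nat.Properties as ℕ
  open import Data.Integer as ℤ using (+_)
  import Data.Integer.Properties as ℤ
  open import Data.Integer.Tactic.RingSolver using (solve-∀)
  open import Data.Fin as Fin using (toℕ; fromℕ; inject₁)
  open import Data.Fin.Properties using (toℕ<n; toℕ-fromℕ; toℕ-inject₁)
  open import Data.Fin.Relation.Unary.Top using (View; view; ‵fromℕ; ‵inject₁)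
  open import Data.Nat.Primality using (Prime)
  open import Relation.Binary.PropositionalEquality as ≡ using (_≡_)

  private
    p = suc q
    H = h ℕ.* q
    hI = hIdx p (suc m) h
    -- the coefficient (-1)^(n-1) λ of φ(e_{n-1})
    c₀ = sign m * lam

  sum-mul1X-φD-suc : ∀ (ys : ℕ → Vect) i k →
    sumE p (λ j → mul1X j (φD (ys j) (Fin.suc i)) k) ≈ scale lam (recompose (λ j → ys j (inject₁ i))) k
  sum-mul1X-φD-suc ys i k =
    trans (sumE-cong p (λ j _ → mul1X-scale j lam (φS (ys j (inject₁ i))) k)) (sym (sumE-*ˡ p lam _))

  sum-mul1X-φD-zero : ∀ (ys : ℕ → Vect) k →
    sumE p (λ j → mul1X j (φD (ys j) Fin.zero) k)
      ≈ scale c₀ (shiftX (ℤ.- + H) (recompose (λ j → ys j (fromℕ m)))) k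
  sum-mul1X-φD-zero ys k = trans (sumE-cong p (λ j _ → scale-shift j)) (sym (sumE-*ˡ p c₀ _))
    where
    scale-shift : ∀ j → mul1X j (φD (ys j) Fin.zero) k ≈ c₀ * mul1X j (φS (ys j (fromℕ m))) (k ℤ.- ℤ.- + H)
    scale-shift j = trans (mul1X-scale j c₀ (shiftX (ℤ.- + H) (φS (ys j (fromℕ m)))) k)
                          (*-congˡ (mul1X-shiftX j (ℤ.- + H) (φS (ys j (fromℕ m))) k))

  module _ (h[p-1]<pⁿ : h ℕ.* q ℕ.< p ℕ.^ suc m) where
    open DigitIndices q (suc m) h h[p-1]<pⁿ

    p*hI-last≤H : p ℕ.* hI m ℕ.≤ H
    p*hI-last≤H = ≡.subst (p ℕ.* hI m ℕ.≤_) hIdx-n≡h[p-1] (p*hIdx≤hIdx-suc ℕ.≤-refl)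

    H≤p*hI-last+q : H ℕ.≤ p ℕ.* hI m ℕ.+ q
    H≤p*hI-last+q = ≡.subst (ℕ._≤ p ℕ.* hI m ℕ.+ q) hIdx-n≡h[p-1] (hIdx-suc≤p*hIdx+q ℕ.≤-refl)

    ψ-preserves-D♯ : IsUnit E lam → ∀ y → InDsharp y → ∀ z → IsPsi y z → InDsharp z
    ψ-preserves-D♯ lam-unit y y∈D♯ z (ys , _ , ys₀≈z , y≈Σ) c =
      vanishesBelow-cong (ys₀≈z c) (ys₀-vanishes (view c))
      where
      ys₀-vanishes : ∀ {c} → View c → VanishesBelow (+ hI (toℕ c)) (ys 0 c)
      ys₀-vanishes ‵fromℕ =
        ≡.subst (λ j → VanishesBelow (+ hI j) (ys 0 (fromℕ m))) (≡.sym (toℕ-fromℕ m))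
          (recompose-vanishesBelow _ p*hI-last≤H
            (vanishesBelow-mono (ℤ.≤-reflexive (H≡0--H (+ H)))
              (vanishesBelow-unshift (ℤ.- + H)
                (vanishesBelow-unscale (unit-* (sign-unit m) lam-unit)
                  (vanishesBelow-cong (λ k → trans (y≈Σ Fin.zero k) (sum-mul1X-φD-zero ys k))
                    (y∈D♯ Fin.zero))))))
        where
        H≡0--H : ∀ H → H ≡ + 0 ℤ.- ℤ.- H
        H≡0--H = solve-∀
      ys₀-vanishes (‵inject₁ i) =
        ≡.subst (λ j → VanishesBelow (+ hI j) (ys 0 (inject₁ i))) (≡.sym (toℕ-inject₁ i))
          (recompose-vanishesBelow _ (p*hIdx≤hIdx-suc (ℕ.m<n⇒m<1+n (toℕ<n i)))
            (vanishesBelow-unscale lam-unit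
              (vanishesBelow-cong (λ k → trans (y≈Σ (Fin.suc i) k) (sum-mul1X-φD-suc ys i k))
                (y∈D♯ (Fin.suc i)))))

    φD-vanishesBelow : ∀ {z} → InDsharp z → ∀ c → VanishesBelow (+ hI (toℕ c) ℤ.- + q) (φD z c)
    φD-vanishesBelow {z} z∈D♯ Fin.zero =
      vanishesBelow-mono (c≤b+q⇒0-q≤b-c H≤p*hI-last+q)
        (scale-vanishesBelow c₀ (shiftX-vanishesBelow (ℤ.- + H) (φS-vanishesBelow z-last-vanishes)))
      where
      z-last-vanishes : VanishesBelow (+ hI m) (z (fromℕ m))
      z-last-vanishes = ≡.subst (λ j → VanishesBelow (+ hI j) (z (fromℕ m))) (toℕ-fromℕ m) (z∈D♯ (fromℕ m))
    φD-vanishesBelow {z} z∈D♯ (Fin.suc i) =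
      vanishesBelow-mono (a≤b+q⇒a-q≤b (hIdx-suc≤p*hIdx+q (ℕ.m<n⇒m<1+n (toℕ<n i))))
        (scale-vanishesBelow lam (φS-vanishesBelow z-vanishes))
      where
      z-vanishes : VanishesBelow (+ hI (toℕ i)) (z (inject₁ i))
      z-vanishes = ≡.subst (λ j → VanishesBelow (+ hI j) (z (inject₁ i))) (toℕ-inject₁ i) (z∈D♯ (inject₁ i))

    module _ (p-prime : Prime p) (char-p : natE E p ≈ 0#) where

      ψ-surjective-on-D♯ : ∀ z → InDsharp z → Σ Vect λ y → InDsharp y × IsPsi y z
      ψ-surjective-on-D♯ z z∈D♯ = y , y∈D♯ , (λ _ → z) , ys∈D , (λ _ _ → refl) , (λ _ _ → refl)
        where
        y : Vect
        y c k = sumE p (λ j → mul1X j (φD z c) k)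
        y∈D♯ : InDsharp y
        y∈D♯ c = vanishesBelow-cong (λ k → sym (geometric-sum-char-p p-prime char-p (φD z c) k))
          (vanishesBelow-mono (ℤ.≤-reflexive (a≡a-q+q (+ hI (toℕ c)) (+ q)))
            (shiftX-vanishesBelow (+ q) (φD-vanishesBelow z∈D♯ c)))
          where
          a≡a-q+q : ∀ a q → a ≡ a ℤ.- q ℤ.+ q
          a≡a-q+q = solve-∀
        ys∈D : ∀ j → j ℕ.< p → InD z
        ys∈D _ _ c = + 0 , vanishesBelow-mono (ℤ.+≤+ ℕ.z≤n) (z∈D♯ c)

open import Data.Nat using (_≤_; _<_; _+_; _*_; _∸_; _^_; z<s)
open import Data.Nat.Properties using (≤-<-trans; *-monoˡ-≤; m≤m+n; ∸-monoʳ-<; m^n>0)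
open import Data.Nat.Primality using (Prime)
open import Data.Integer using (ℤ)

corollary2p2p2 : (p : ℕ) → Prime p →
    (E : CommutativeRing 0ℓ 0ℓ) → IsFiniteFieldOfChar E p →
    (n : ℕ) → 2 ≤ n →
    (h : ℕ) → 1 ≤ h → (h + 1) * (p ∸ 1) ≤ p ^ n ∸ 1 → Primitive p n h →
    (s : ℤ) → (lam : CommutativeRing.Carrier E) → IsUnit E lam →
    let open Model E p n h lam in
      (∀ y → InDsharp y → ∀ z → IsPsi y z → InDsharp z)
    × (∀ z → InDsharp z → Σ Vect λ y → InDsharp y × IsPsi y z)
corollary2p2p2 zero () _ _ _ _ _ _ _ _ _ _ _
corollary2p2p2 (suc q) _ _ _ zero () _ _ _ _ _ _ _
corollary2p2p2 (suc q) p-prime E (_ , _ , _ , char-p) (suc m) _ h _ bound _ _ lam lam-unit =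
  ψ-preserves-D♯ E q m h lam h[p-1]<pⁿ lam-unit , ψ-surjective-on-D♯ E q m h lam h[p-1]<pⁿ p-prime char-p
  where
  h[p-1]<pⁿ : h * q < suc q ^ suc m
  h[p-1]<pⁿ = ≤-<-trans (*-monoˡ-≤ q (m≤m+n h 1)) (≤-<-trans bound (∸-monoʳ-< z<s (m^n>0 (suc q) (suc m))))
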